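{- Let $K$ be a finite simplicial complex, $s\ge1$, $r\ge1$, and $\mathrm{col}\colon V(K)\to\{1,\dots,r\}$ any map. Then the $s$-monochrome set $M^s(\mathrm{col})=\{\sigma\in F^s(K)\mid |\mathrm{col}(\sigma)|=1\}$ belongs to $L^s(K)$.
   Context: $F^s(K)$ is the set of $s$-simplices (faces with $s+1$ vertices) of $K$. For $S\subseteq F^s(K)$, its connected components are the equivalence classes of the smallest equivalence relation on $S$ relating any two simplices with nonempty intersection; $V(S)=\bigcup S$; $S$ is closed if $\{\sigma\in F^s(K)\mid\sigma\subseteq V(S)\}=S$. $L^s(K)$ is the set of all subsets of $F^s(K)$ all of whose connected components are closed. -}

module Defs where

open import Data.Nat using (ℕ; suc)
open import Data.Fin using (Fin)
open import Data.Fin.Subset using (Subset; _∈_; _⊆_; _∩_; Nonempty; ⁅_⁆; ∣_∣)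
open import Data.Fin.Subset.Properties using (_∈?_)
open import Data.Fin.Properties using (any?; _≟_)
open import Data.Product using (Σ; ∃; _×_; _,_; proj₁)
open import Data.Vec using (tabulate)
open import Relation.Nullary.Decidable using (⌊_⌋; _×-dec_)
open import Relation.Binary.PropositionalEquality using (_≡_)
open import Relation.Binary.Construct.Closure.Equivalence using (EqClosure)
open import Function.Bundles using (_⇔_)

-- A finite simplicial complex on the vertex set Fin n: faces are nonempty
-- subsets, closed under taking nonempty subsets, and every element of Fin n
-- is a vertex (so V(K) = Fin n).
record SimplicialComplex (n : ℕ) : Set₁ where
  field
    Face      : Subset n → Set
    nonempty  : ∀ {σ} → Face σ → Nonempty σ
    down      : ∀ {σ τ} → Face σ → τ ⊆ σ → Nonempty τ → Face τ
    vertices  : ∀ v → Face ⁅ v ⁆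
open SimplicialComplex public

F : ∀ {n} → ℕ → SimplicialComplex n → Subset n → Set
F s K σ = Face K σ × ∣ σ ∣ ≡ suc s

Elem : ∀ {n} → (Subset n → Set) → Set
Elem {n} S = Σ (Subset n) S

Adj : ∀ {n} (S : Subset n → Set) → Elem S → Elem S → Set
Adj S (σ , _) (τ , _) = Nonempty (σ ∩ τ)

InComp : ∀ {n} (S : Subset n → Set) → Elem S → Subset n → Set
InComp S x τ = Σ (S τ) λ p → EqClosure (Adj S) x (τ , p)

InV : ∀ {n} → (Subset n → Set) → Fin n → Set
InV {n} C v = ∃ λ (τ : Subset n) → C τ × v ∈ τ

Closed : ∀ {n} → ℕ → SimplicialComplex n → (Subset n → Set) → Set
Closed s K C = ∀ σ → ((F s K σ × (∀ {v} → v ∈ σ → InV C v)) ⇔ C σ)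

InL : ∀ {n} → ℕ → SimplicialComplex n → (Subset n → Set) → Set
InL s K S = (∀ σ → S σ → F s K σ) × (∀ (x : Elem S) → Closed s K (InComp S x))

image : ∀ {n r} → (Fin n → Fin r) → Subset n → Subset r
image col σ = tabulate λ c → ⌊ any? (λ v → (v ∈? σ) ×-dec (col v ≟ c)) ⌋

Mono : ∀ {n r} → ℕ → SimplicialComplex n → (Fin n → Fin r) → Subset n → Set
Mono s K col σ = F s K σ × ∣ image col σ ∣ ≡ 1

-- Two simplices of M^s(col) that share a vertex carry the same colour, so every
-- connected component C of M^s(col) is monochrome of a single colour c. A
-- simplex σ ∈ F^s(K) with σ ⊆ V(C) then has all its vertices coloured c, so it
-- lies in M^s(col), and since it meets some simplex of C it lies in C.
module Submission where

open import Defs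
open import Data.Nat using (ℕ; _≤_; _<_)
open import Data.Nat.Properties using (<-irrefl)
open import Data.Fin using (Fin)
open import Data.Fin.Properties using (any?; _≟_)
open import Data.Fin.Subset using (Subset; _∈_; _⊆_; _⊂_; ⁅_⁆; ∣_∣)
open import Data.Fin.Subset.Properties
  using (_∈?_; x∈⁅x⁆; x∈⁅y⁆⇒x≡y; ∣⁅x⁆∣≡1; ⊆-antisym; p⊂q⇒∣p∣<∣q∣; x∈p∩q⁺; p∩q⊆p; p∩q⊆q)
open import Data.Product using (∃; _×_; _,_; proj₁; proj₂)
open import Data.Vec.Properties using (lookup∘tabulate; []=⇒lookup; lookup⇒[]=)
open import Data.Bool.Properties using (T-≡)
open import Data.Empty using (⊥-elim)
open import Relation.Nullary using (yes; no)
open import Relation.Nullary.Decidable using (_×-dec_; toWitness; fromWitness)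
open import Relation.Binary.PropositionalEquality
  using (_≡_; refl; sym; trans; subst; cong; isEquivalence)
open import Relation.Binary.Construct.Closure.Equivalence using (EqClosure; gfold)
open import Relation.Binary.Construct.Closure.Symmetric using (fwd)
open import Relation.Binary.Construct.Closure.ReflexiveTransitive using (ε; _◅_; _◅◅_)
open import Function.Bundles using (mk⇔; Equivalence)

∣p∣≡1⇒∈-unique : ∀ {r} {p : Subset r} {c d} → ∣ p ∣ ≡ 1 → c ∈ p → d ∈ p → d ≡ c
∣p∣≡1⇒∈-unique {p = p} {c} {d} ∣p∣≡1 c∈p d∈p with d ≟ c
... | yes d≡c = d≡c
... | no d≢c = ⊥-elim (<-irrefl refl ∣⁅c⁆∣<1)
  where
  ⁅c⁆⊂p : ⁅ c ⁆ ⊂ p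
  ⁅c⁆⊂p = (λ x∈⁅c⁆ → subst (_∈ p) (sym (x∈⁅y⁆⇒x≡y c x∈⁅c⁆)) c∈p)
        , d , d∈p , λ d∈⁅c⁆ → d≢c (x∈⁅y⁆⇒x≡y c d∈⁅c⁆)
  ∣⁅c⁆∣<1 : 1 < 1
  ∣⁅c⁆∣<1 = subst (_< 1) (∣⁅x⁆∣≡1 c) (subst (∣ ⁅ c ⁆ ∣ <_) ∣p∣≡1 (p⊂q⇒∣p∣<∣q∣ ⁅c⁆⊂p))

module _ {n r : ℕ} (col : Fin n → Fin r) where

  Monochromatic : Fin r → Subset n → Set
  Monochromatic c σ = ∀ {v} → v ∈ σ → col v ≡ c

  ∈-image⁺ : ∀ {σ v} → v ∈ σ → col v ∈ image col σ
  ∈-image⁺ {σ} {v} v∈σ = lookup⇒[]= (col v) (image col σ)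
    (trans (lookup∘tabulate _ (col v))
      (Equivalence.to T-≡ (fromWitness {a? = any? (λ w → (w ∈? σ) ×-dec (col w ≟ col v))}
        (v , v∈σ , refl))))

  ∈-image⁻ : ∀ {σ c} → c ∈ image col σ → ∃ λ v → v ∈ σ × col v ≡ c
  ∈-image⁻ {σ} {c} c∈ = toWitness {a? = any? (λ w → (w ∈? σ) ×-dec (col w ≟ c))}
    (Equivalence.from T-≡ (trans (sym (lookup∘tabulate _ c)) ([]=⇒lookup c∈)))

  ∣image∣≡1⇒monochromatic : ∀ {σ v} → ∣ image col σ ∣ ≡ 1 → v ∈ σ → Monochromatic (col v) σ
  ∣image∣≡1⇒monochromatic ∣image∣≡1 v∈σ w∈σ =
    ∣p∣≡1⇒∈-unique ∣image∣≡1 (∈-image⁺ v∈σ) (∈-image⁺ w∈σ)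

  monochromatic⇒∣image∣≡1 : ∀ {σ c v} → v ∈ σ → Monochromatic c σ → ∣ image col σ ∣ ≡ 1
  monochromatic⇒∣image∣≡1 {σ} {c} {v} v∈σ mono = trans (cong ∣_∣ (⊆-antisym image⊆⁅c⁆ ⁅c⁆⊆image)) (∣⁅x⁆∣≡1 c)
    where
    image⊆⁅c⁆ : image col σ ⊆ ⁅ c ⁆
    image⊆⁅c⁆ d∈ with ∈-image⁻ d∈
    ... | w , w∈σ , colw≡d = subst (_∈ ⁅ c ⁆) (trans (sym (mono w∈σ)) colw≡d) (x∈⁅x⁆ c)
    ⁅c⁆⊆image : ⁅ c ⁆ ⊆ image col σ
    ⁅c⁆⊆image d∈⁅c⁆ = subst (_∈ image col σ) (trans (mono v∈σ) (sym (x∈⁅y⁆⇒x≡y c d∈⁅c⁆))) (∈-image⁺ v∈σ)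

module _ {n : ℕ} (K : SimplicialComplex n) (s : ℕ) where

  component-closed : ∀ {S : Subset n → Set} → (∀ σ → S σ → F s K σ) → (x : Elem S) →
                     (∀ σ → F s K σ → (∀ {v} → v ∈ σ → InV (InComp S x) v) → S σ) →
                     Closed s K (InComp S x)
  component-closed {S} S⊆F x covered⇒S σ = mk⇔ to from
    where
    to : F s K σ × (∀ {v} → v ∈ σ → InV (InComp S x) v) → InComp S x σ
    to (Fσ , σ⊆V) with nonempty K (proj₁ Fσ)
    ... | w , w∈σ with σ⊆V w∈σ
    ...   | τ , (_ , x~τ) , w∈τ =
      covered⇒S σ Fσ σ⊆V , (x~τ ◅◅ (fwd (w , x∈p∩q⁺ (w∈τ , w∈σ)) ◅ ε))
    from : InComp S x σ → F s K σ × (∀ {v} → v ∈ σ → InV (InComp S x) v)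
    from σ∈C = S⊆F σ (proj₁ σ∈C) , λ v∈σ → σ , σ∈C , v∈σ

  module _ {r : ℕ} (col : Fin n → Fin r) where

    private
      M = Mono s K col

    colour : Elem M → Fin r
    colour (_ , (Fσ , _) , _) = col (proj₁ (nonempty K Fσ))

    colour-monochromatic : (x : Elem M) → Monochromatic col (colour x) (proj₁ x)
    colour-monochromatic (_ , (Fσ , _) , ∣image∣≡1) v∈σ =
      ∣image∣≡1⇒monochromatic col ∣image∣≡1 (proj₂ (nonempty K Fσ)) v∈σ

    Adj⇒colour≡ : ∀ {x y} → Adj M x y → colour x ≡ colour y
    Adj⇒colour≡ {x} {y} (w , w∈σ∩τ) =
      trans (sym (colour-monochromatic x (p∩q⊆p _ _ w∈σ∩τ)))
            (colour-monochromatic y (p∩q⊆q _ _ w∈σ∩τ))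

    component-colour : ∀ {x y} → EqClosure (Adj M) x y → colour x ≡ colour y
    component-colour = gfold isEquivalence colour (λ {x} {y} → Adj⇒colour≡ {x} {y})

    covered-by-component⇒Mono : (x : Elem M) → ∀ σ → F s K σ →
                                (∀ {v} → v ∈ σ → InV (InComp M x) v) → M σ
    covered-by-component⇒Mono x σ Fσ σ⊆V =
      Fσ , monochromatic⇒∣image∣≡1 col (proj₂ (nonempty K (proj₁ Fσ))) coloured-x
      where
      coloured-x : Monochromatic col (colour x) σ
      coloured-x v∈σ with σ⊆V v∈σ
      ... | τ , (τ∈M , x~τ) , v∈τ =
        trans (colour-monochromatic (τ , τ∈M) v∈τ) (sym (component-colour x~τ))

lemma2p23 : ∀ {n} (K : SimplicialComplex n) (s r : ℕ) → 1 ≤ s → 1 ≤ r →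
            (col : Fin n → Fin r) → InL s K (Mono s K col)
lemma2p23 K s r _ _ col =
    Mono⊆F
  , λ x → component-closed K s Mono⊆F x (covered-by-component⇒Mono K s col x)
  where
  Mono⊆F : ∀ σ → Mono s K col σ → F s K σ
  Mono⊆F _ = proj₁
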